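{- Let $H$ be an $(8,3)$-bigraph with parts $A,B$ and with an obstruction $X$ having type $i$ for some $i\in[4]$ (for types 2 and 3, let $x_1$ be the vertex from the definition of that type). Let $M_1,M_2$ be matchings between $A$ and $B$ and let $H':=H+M_1-M_2$ (on the same parts), and suppose $H'$ is also an $(8,3)$-bigraph. Then $H'$ has a 1-factor if any of the following holds: (1) $X$ has type 1 and $H'$ contains a matching of size 2 from $X$ to $B\setminus N_H(X)$; (2) $X$ has type 2 and $H'$ contains a matching of size 2 from $X\cup\{x_1\}$ to $B\setminus N_H(X)$; (3) $X$ has type 3 and $H'$ contains a matching of size 2 from $X\cup\{x_1\}$ to $B\setminus N_H(X)$; (4) $X$ has type 4 and $H'$ contains an edge from $X$ to $B\setminus N_H(X)$.
   Context: A bigraph is a bipartite graph with parts $A$ and $B$ such that $|A|=|B|$; an $(s,t)$-bigraph is a bigraph with $|A|=|B|=s$ and minimum degree at least $t$. In an $(8,3)$-bigraph $H$, an obstruction is a set $X\subseteq A$ with $|N(X)|<|X|$. An obstruction $X$ has type 1 if $|X|=5$ and $|N(X)|=3$; type 2 if $|X|=4$, $|N(X)|=3$, and there exist $x_1\in A\setminus X$ and an edge $e_1$ incident with $x_1$ such that $|N_H(X\cup\{x_1\})|=4$ but $|N_{H-e_1}(X\cup\{x_1\})|=3$; type 3 if $|X|=4$, $|N(X)|=3$, and there exist $x_1\in A\setminus X$ and edges $e_1,e_2$ incident with $x_1$ such that $|N_H(X\cup\{x_1\})|=5$ but $|N_{H-\{e_1,e_2\}}(X\cup\{x_1\})|=3$;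 and type 4 if $|X|=4$, $|N(X)|=3$, but $X$ is not a subset of any obstruction having type 1, 2, or 3. -}

module Defs where

open import Data.Nat using (ℕ; _≤_; _<_)
open import Data.Bool using (Bool; true; false; _∧_; _∨_; not)
open import Data.Fin using (Fin; zero; suc)
open import Data.Fin.Properties using (_≟_)
open import Data.Vec using (tabulate; lookup)
open import Data.Fin.Subset using (Subset; _∈_; _∉_; _⊆_; ∣_∣; _∪_; ⁅_⁆; ∁)
open import Data.Product using (Σ; _×_; ∃; ∃-syntax)
open import Data.Sum using (_⊎_)
open import Relation.Binary.PropositionalEquality using (_≡_; _≢_)
open import Relation.Nullary using (¬_; does)
open import Function.Definitions using (Injective)

-- A bigraph with parts A = Fin n and B = Fin n, given by its (Boolean)
-- adjacency relation: G a b ≡ true iff a ∈ A is adjacent to b ∈ B.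
BiGraph : ℕ → Set
BiGraph n = Fin n → Fin n → Bool

anyFin : {n : ℕ} → (Fin n → Bool) → Bool
anyFin {ℕ.zero} f = false
anyFin {ℕ.suc n} f = f zero ∨ anyFin (λ i → f (suc i))

Edge : {n : ℕ} → BiGraph n → Fin n → Fin n → Set
Edge G a b = G a b ≡ true

degA : {n : ℕ} → BiGraph n → Fin n → ℕ
degA G a = ∣ tabulate (λ b → G a b) ∣

degB : {n : ℕ} → BiGraph n → Fin n → ℕ
degB G b = ∣ tabulate (λ a → G a b) ∣

IsBigraph : (s t : ℕ) → BiGraph s → Set
IsBigraph s t G = (∀ a → t ≤ degA G a) × (∀ b → t ≤ degB G b)

N : {n : ℕ} → BiGraph n → Subset n → Subset n
N G X = tabulate (λ b → anyFin (λ a → lookup X a ∧ G a b))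

delEdge : {n : ℕ} → BiGraph n → Fin n → Fin n → BiGraph n
delEdge G a b a' b' = G a' b' ∧ not (does (a ≟ a') ∧ does (b ≟ b'))

_+E_ : {n : ℕ} → BiGraph n → BiGraph n → BiGraph n
(G +E M) a b = G a b ∨ M a b

_-E_ : {n : ℕ} → BiGraph n → BiGraph n → BiGraph n
(G -E M) a b = G a b ∧ not (M a b)

IsMatching : {n : ℕ} → BiGraph n → Set
IsMatching M =
  (∀ a b b' → Edge M a b → Edge M a b' → b ≡ b') ×
  (∀ a a' b → Edge M a b → Edge M a' b → a ≡ a')

-- a 1-factor (perfect matching): an injective map σ : A → B
-- (hence a bijection) with every a σ(a) an edge
HasOneFactor : {n : ℕ} → BiGraph n → Set
HasOneFactor G = Σ (Fin _ → Fin _) λ σ → Injective _≡_ _≡_ σ × (∀ a → Edge G a (σ a))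

HasMatching2 : {n : ℕ} → BiGraph n → Subset n → Subset n → Set
HasMatching2 G S T =
  ∃[ a₁ ] ∃[ b₁ ] ∃[ a₂ ] ∃[ b₂ ]
    (a₁ ≢ a₂) × (b₁ ≢ b₂) × (a₁ ∈ S) × (a₂ ∈ S) × (b₁ ∈ T) × (b₂ ∈ T)
    × Edge G a₁ b₁ × Edge G a₂ b₂

HasEdgeBetween : {n : ℕ} → BiGraph n → Subset n → Subset n → Set
HasEdgeBetween G S T = ∃[ a ] ∃[ b ] (a ∈ S) × (b ∈ T) × Edge G a b

IsObstruction : {n : ℕ} → BiGraph n → Subset n → Set
IsObstruction G X = ∣ N G X ∣ < ∣ X ∣

Type1 : {n : ℕ} → BiGraph n → Subset n → Set
Type1 G X = (∣ X ∣ ≡ 5) × (∣ N G X ∣ ≡ 3)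

Type2Wit : {n : ℕ} → BiGraph n → Subset n → Fin n → Fin n → Set
Type2Wit G X x₁ b₁ =
  (∣ X ∣ ≡ 4) × (∣ N G X ∣ ≡ 3) × (x₁ ∉ X) × Edge G x₁ b₁
  × (∣ N G (X ∪ ⁅ x₁ ⁆) ∣ ≡ 4)
  × (∣ N (delEdge G x₁ b₁) (X ∪ ⁅ x₁ ⁆) ∣ ≡ 3)

Type2 : {n : ℕ} → BiGraph n → Subset n → Set
Type2 G X = ∃[ x₁ ] ∃[ b₁ ] Type2Wit G X x₁ b₁

Type3Wit : {n : ℕ} → BiGraph n → Subset n → Fin n → Fin n → Fin n → Set
Type3Wit G X x₁ b₁ b₂ =
  (∣ X ∣ ≡ 4) × (∣ N G X ∣ ≡ 3) × (x₁ ∉ X) × Edge G x₁ b₁ × Edge G x₁ b₂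
  × (∣ N G (X ∪ ⁅ x₁ ⁆) ∣ ≡ 5)
  × (∣ N (delEdge (delEdge G x₁ b₁) x₁ b₂) (X ∪ ⁅ x₁ ⁆) ∣ ≡ 3)

Type3 : {n : ℕ} → BiGraph n → Subset n → Set
Type3 G X = ∃[ x₁ ] ∃[ b₁ ] ∃[ b₂ ] Type3Wit G X x₁ b₁ b₂

Type4 : {n : ℕ} → BiGraph n → Subset n → Set
Type4 G X =
  (∣ X ∣ ≡ 4) × (∣ N G X ∣ ≡ 3)
  × ¬ (∃[ Y ] (X ⊆ Y) × IsObstruction G Y × (Type1 G Y ⊎ Type2 G Y ⊎ Type3 G Y))

{-# OPTIONS --safe #-}
-- By Hall's theorem it suffices to show that G = H + M₁ - M₂ has no
-- obstruction. For such an obstruction Y let Z = B ∖ N_G(Y): then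
-- |Y| + |Z| ≥ 9 and no edge of G joins Y to Z, so the H-edges between Y and Z
-- lie in the matching M₂ and every vertex of Y (of Z) has at most one
-- H-neighbour in Z (in Y). Around the obstruction X, H joins the parts X,
-- A ∖ X, N_H(X), B ∖ N_H(X) (refined by x₁ for types 2 and 3) completely or
-- with large degree, by the minimum degree 3 and, for type 4, by maximality;
-- the given edges of G from X to B ∖ N_H(X) must each leave Y or Z; and
-- minimum degree 3 in G gives |Y|, |Z| ≤ 5. The sizes of Y and Z on the parts
-- cannot satisfy all these inequalities at once.
module Submission where

open import Defs
open import Data.Bool using (Bool; true; false; _∧_; _∨_)
open import Data.Bool.Properties using (∧-conicalˡ; ∧-conicalʳ; ∨-zeroʳ; ∧-zeroʳ; ∧-identityʳ)
open import Data.Empty using (⊥-elim)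
open import Data.Fin using (Fin; zero; suc)
open import Data.Fin.Properties using (_≟_)
open import Data.Fin.Subset
  using (Subset; inside; outside; _∈_; _∉_; _⊆_; _⊂_; ∣_∣; _∩_; _∪_; ∁; ⁅_⁆; ⊤; Nonempty; Empty)
open import Data.Fin.Subset.Properties
open import Data.Nat using (ℕ; zero; suc; _+_; _∸_; _≤_; _<_; _≤?_; _<?_; z≤n; s≤s)
open import Data.Nat.Properties
  using (≤-refl; ≤-trans; ≤-antisym; ≤-reflexive; ≤-pred; <⇒≱; ≰⇒>; ≮⇒≥; n≤0⇒n≡0; n≤1+n; m≤n⇒m≤1+n;
         m≤m+n; m≤n+m; m+n≤o⇒n≤o; +-suc; +-comm; +-assoc; +-identityʳ; +-commutativeSemigroup;
         +-mono-≤; +-monoˡ-≤; +-monoʳ-≤; +-monoˡ-<; +-cancelˡ-≤; +-cancelˡ-≡; suc-injective;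
         m∸n+n≡m; m+[n∸m]≡n; allUpTo?; module ≤-Reasoning)
open import Algebra.Properties.CommutativeSemigroup +-commutativeSemigroup using (interchange)
open import Data.Product using (_×_; _,_; proj₁; proj₂; map₁; ∃; ∃-syntax; ∃₂)
open import Data.Sum using (_⊎_; inj₁; inj₂)
open import Data.Vec using (_∷_; []; tabulate; lookup)
open import Data.Vec.Properties using (lookup∘tabulate; []=⇒lookup; lookup⇒[]=)
open import Relation.Binary.PropositionalEquality
  using (_≡_; _≢_; refl; sym; trans; cong; cong₂; subst; subst₂; module ≡-Reasoning)
open import Relation.Nullary using (¬_; Dec; yes; no; contradiction)
open import Relation.Nullary.Decidable
  using (_×-dec_; _→-dec_; ¬?; from-yes; dec-true; dec-false; decidable-stable)
open import Function using (id; const)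

private
  variable
    n : ℕ
    x y : Fin n
    p q s : Subset n

-- Counting in finite subsets

∣p∣≡∣p∩q∣+∣p∩∁q∣ : ∀ (p q : Subset n) → ∣ p ∣ ≡ ∣ p ∩ q ∣ + ∣ p ∩ ∁ q ∣
∣p∣≡∣p∩q∣+∣p∩∁q∣ []            []            = refl
∣p∣≡∣p∩q∣+∣p∩∁q∣ (inside  ∷ p) (inside  ∷ q) = cong suc (∣p∣≡∣p∩q∣+∣p∩∁q∣ p q)
∣p∣≡∣p∩q∣+∣p∩∁q∣ (inside  ∷ p) (outside ∷ q) =
  trans (cong suc (∣p∣≡∣p∩q∣+∣p∩∁q∣ p q)) (sym (+-suc _ _))
∣p∣≡∣p∩q∣+∣p∩∁q∣ (outside ∷ p) (_       ∷ q) = ∣p∣≡∣p∩q∣+∣p∩∁q∣ p q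

∣p∪q∣≡∣p∣+∣∁p∩q∣ : ∀ (p q : Subset n) → ∣ p ∪ q ∣ ≡ ∣ p ∣ + ∣ ∁ p ∩ q ∣
∣p∪q∣≡∣p∣+∣∁p∩q∣ []            []            = refl
∣p∪q∣≡∣p∣+∣∁p∩q∣ (inside  ∷ p) (_       ∷ q) = cong suc (∣p∪q∣≡∣p∣+∣∁p∩q∣ p q)
∣p∪q∣≡∣p∣+∣∁p∩q∣ (outside ∷ p) (inside  ∷ q) =
  trans (cong suc (∣p∪q∣≡∣p∣+∣∁p∩q∣ p q)) (sym (+-suc _ _))
∣p∪q∣≡∣p∣+∣∁p∩q∣ (outside ∷ p) (outside ∷ q) = ∣p∪q∣≡∣p∣+∣∁p∩q∣ p q

∣p∪q∣≤∣p∣+∣q∣ : ∀ (p q : Subset n) → ∣ p ∪ q ∣ ≤ ∣ p ∣ + ∣ q ∣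
∣p∪q∣≤∣p∣+∣q∣ p q = ≤-trans (≤-reflexive (∣p∪q∣≡∣p∣+∣∁p∩q∣ p q)) (+-monoʳ-≤ ∣ p ∣ (∣p∩q∣≤∣q∣ (∁ p) q))

∣p∩q∣≤m : ∀ (p q : Subset n) {m} → ∣ q ∣ ≡ m → ∣ p ∩ q ∣ ≤ m
∣p∩q∣≤m p q ∣q∣≡m = ≤-trans (∣p∩q∣≤∣q∣ p q) (≤-reflexive ∣q∣≡m)

∩-monoˡ : ∀ {p p′ : Subset n} → p ⊆ p′ → ∀ q → p ∩ q ⊆ p′ ∩ q
∩-monoˡ {p = p} p⊆p′ q x∈p∩q = x∈p∩q⁺ (p⊆p′ (proj₁ (x∈p∩q⁻ p q x∈p∩q)) , proj₂ (x∈p∩q⁻ p q x∈p∩q))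

∩-monoʳ : ∀ p {q q′ : Subset n} → q ⊆ q′ → p ∩ q ⊆ p ∩ q′
∩-monoʳ p {q} q⊆q′ x∈p∩q = x∈p∩q⁺ (proj₁ (x∈p∩q⁻ p q x∈p∩q) , q⊆q′ (proj₂ (x∈p∩q⁻ p q x∈p∩q)))

p⊆q⇒q∩p≡p : p ⊆ q → q ∩ p ≡ p
p⊆q⇒q∩p≡p {p = p} {q = q} p⊆q = ⊆-antisym (p∩q⊆q q p) (λ x∈p → x∈p∩q⁺ (p⊆q x∈p , x∈p))

∣s∩q∣≡∣s∩p∣+∣s∩[q∩∁p]∣ : ∀ (s : Subset n) → p ⊆ q → ∣ s ∩ q ∣ ≡ ∣ s ∩ p ∣ + ∣ s ∩ (q ∩ ∁ p) ∣
∣s∩q∣≡∣s∩p∣+∣s∩[q∩∁p]∣ {p = p} {q = q} s p⊆q = begin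
  ∣ s ∩ q ∣                              ≡⟨ ∣p∣≡∣p∩q∣+∣p∩∁q∣ (s ∩ q) p ⟩
  ∣ (s ∩ q) ∩ p ∣ + ∣ (s ∩ q) ∩ ∁ p ∣    ≡⟨ cong₂ (λ u v → ∣ u ∣ + ∣ v ∣)
                                              (trans (∩-assoc s q p) (cong (s ∩_) (p⊆q⇒q∩p≡p p⊆q)))
                                              (∩-assoc s q (∁ p)) ⟩
  ∣ s ∩ p ∣ + ∣ s ∩ (q ∩ ∁ p) ∣          ∎
  where open ≡-Reasoning

p⊆q⇒∣q∣≡∣p∣+∣q∩∁p∣ : p ⊆ q → ∣ q ∣ ≡ ∣ p ∣ + ∣ q ∩ ∁ p ∣
p⊆q⇒∣q∣≡∣p∣+∣q∩∁p∣ {p = p} {q = q} p⊆q =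
  trans (∣p∣≡∣p∩q∣+∣p∩∁q∣ q p) (cong (λ r → ∣ r ∣ + ∣ q ∩ ∁ p ∣) (p⊆q⇒q∩p≡p p⊆q))

∣s∣≡∣s∩p∣+∣s∩[q∩∁p]∣+∣s∩∁q∣ : ∀ (s : Subset n) → p ⊆ q →
                              ∣ s ∣ ≡ ∣ s ∩ p ∣ + ∣ s ∩ (q ∩ ∁ p) ∣ + ∣ s ∩ ∁ q ∣
∣s∣≡∣s∩p∣+∣s∩[q∩∁p]∣+∣s∩∁q∣ {q = q} s p⊆q =
  trans (∣p∣≡∣p∩q∣+∣p∩∁q∣ s q) (cong (_+ ∣ s ∩ ∁ q ∣) (∣s∩q∣≡∣s∩p∣+∣s∩[q∩∁p]∣ s p⊆q))

∣s∩∁p∣≡∣s∩[q∩∁p]∣+∣s∩∁q∣ : ∀ (s : Subset n) → p ⊆ q → ∣ s ∩ ∁ p ∣ ≡ ∣ s ∩ (q ∩ ∁ p) ∣ + ∣ s ∩ ∁ q ∣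
∣s∩∁p∣≡∣s∩[q∩∁p]∣+∣s∩∁q∣ {p = p} {q = q} s p⊆q = +-cancelˡ-≡ ∣ s ∩ p ∣ _ _ (begin
  ∣ s ∩ p ∣ + ∣ s ∩ ∁ p ∣                                ≡⟨ ∣p∣≡∣p∩q∣+∣p∩∁q∣ s p ⟨
  ∣ s ∣                                                  ≡⟨ ∣s∣≡∣s∩p∣+∣s∩[q∩∁p]∣+∣s∩∁q∣ s p⊆q ⟩
  ∣ s ∩ p ∣ + ∣ s ∩ (q ∩ ∁ p) ∣ + ∣ s ∩ ∁ q ∣            ≡⟨ +-assoc ∣ s ∩ p ∣ _ _ ⟩
  ∣ s ∩ p ∣ + (∣ s ∩ (q ∩ ∁ p) ∣ + ∣ s ∩ ∁ q ∣)          ∎)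
  where open ≡-Reasoning

p⊆∁q⇒∣p∣+∣q∣≤n : ∀ {n} {p q : Subset n} → p ⊆ ∁ q → ∣ p ∣ + ∣ q ∣ ≤ n
p⊆∁q⇒∣p∣+∣q∣≤n {n} {p} {q} p⊆∁q = begin
  ∣ p ∣ + ∣ q ∣        ≤⟨ +-monoˡ-≤ ∣ q ∣ (p⊆q⇒∣p∣≤∣q∣ p⊆∁q) ⟩
  ∣ ∁ q ∣ + ∣ q ∣      ≡⟨ cong (_+ ∣ q ∣) (∣∁p∣≡n∸∣p∣ q) ⟩
  n ∸ ∣ q ∣ + ∣ q ∣    ≡⟨ m∸n+n≡m (∣p∣≤n q) ⟩
  n                    ∎
  where open ≤-Reasoning

x∈p⇒0<∣p∣ : x ∈ p → 0 < ∣ p ∣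
x∈p⇒0<∣p∣ x∈p = ≤-trans (s≤s z≤n) (x∈p⇒∣p-x∣<∣p∣ x∈p)

Empty⇒∣p∣≡0 : ∀ {n} {p : Subset n} → Empty p → ∣ p ∣ ≡ 0
Empty⇒∣p∣≡0 {n} empty = trans (cong ∣_∣ (Empty-unique empty)) (∣⊥∣≡0 n)

0<∣p∣⇒Nonempty : 0 < ∣ p ∣ → Nonempty p
0<∣p∣⇒Nonempty {p = p} 0<∣p∣ with nonempty? p
... | yes ne    = ne
... | no  empty = contradiction (Empty⇒∣p∣≡0 empty) λ ∣p∣≡0 → <⇒≱ 0<∣p∣ (≤-reflexive ∣p∣≡0)

p⊆q∧∣q∣≤∣p∣⇒q⊆p : p ⊆ q → ∣ q ∣ ≤ ∣ p ∣ → q ⊆ p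
p⊆q∧∣q∣≤∣p∣⇒q⊆p {p = p} p⊆q ∣q∣≤∣p∣ {x} x∈q with x ∈? p
... | yes x∈p = x∈p
... | no  x∉p = contradiction ∣q∣≤∣p∣ (<⇒≱ (p⊂q⇒∣p∣<∣q∣ (p⊆q , x , x∈q , x∉p)))

x∈p⇒∣p∩⁅x⁆∣≡1 : x ∈ p → ∣ p ∩ ⁅ x ⁆ ∣ ≡ 1
x∈p⇒∣p∩⁅x⁆∣≡1 {x = x} {p = p} x∈p = ≤-antisym
  (≤-trans (∣p∩q∣≤∣q∣ p ⁅ x ⁆) (≤-reflexive (∣⁅x⁆∣≡1 x)))
  (x∈p⇒0<∣p∣ (x∈p∩q⁺ (x∈p , x∈⁅x⁆ x)))

x∈p⇒∣p∣≡1+∣p∩∁⁅x⁆∣ : x ∈ p → ∣ p ∣ ≡ suc ∣ p ∩ ∁ ⁅ x ⁆ ∣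
x∈p⇒∣p∣≡1+∣p∩∁⁅x⁆∣ {x = x} {p = p} x∈p =
  trans (∣p∣≡∣p∩q∣+∣p∩∁q∣ p ⁅ x ⁆) (cong (_+ ∣ p ∩ ∁ ⁅ x ⁆ ∣) (x∈p⇒∣p∩⁅x⁆∣≡1 x∈p))

∈-remove⁺ : y ∈ p → y ≢ x → y ∈ p ∩ ∁ ⁅ x ⁆
∈-remove⁺ y∈p y≢x = x∈p∩q⁺ (y∈p , x∉p⇒x∈∁p (x≢y⇒x∉⁅y⁆ y≢x))

∈-remove⁻ : y ∈ p ∩ ∁ ⁅ x ⁆ → y ≢ x
∈-remove⁻ {p = p} {x = x} y∈ = x∉⁅y⁆⇒x≢y (x∈∁p⇒x∉p (proj₂ (x∈p∩q⁻ p (∁ ⁅ x ⁆) y∈)))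

∣p∣≤1+∣p∩∁⁅x⁆∣ : ∀ (p : Subset n) x → ∣ p ∣ ≤ suc ∣ p ∩ ∁ ⁅ x ⁆ ∣
∣p∣≤1+∣p∩∁⁅x⁆∣ p x = ≤-trans (≤-reflexive (∣p∣≡∣p∩q∣+∣p∩∁q∣ p ⁅ x ⁆))
  (+-monoˡ-≤ ∣ p ∩ ∁ ⁅ x ⁆ ∣ (≤-trans (∣p∩q∣≤∣q∣ p ⁅ x ⁆) (≤-reflexive (∣⁅x⁆∣≡1 x))))

∣p∣≡0⇒x∉p : ∣ p ∣ ≡ 0 → x ∉ p
∣p∣≡0⇒x∉p ∣p∣≡0 x∈p = <⇒≱ (x∈p⇒0<∣p∣ x∈p) (≤-reflexive ∣p∣≡0)

∣p∣≡1⇒singleton : ∣ p ∣ ≡ 1 → ∃[ x ] x ∈ p × (∀ {y} → y ∈ p → y ≡ x)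
∣p∣≡1⇒singleton {p = p} ∣p∣≡1 with 0<∣p∣⇒Nonempty (≤-reflexive (sym ∣p∣≡1))
... | x , x∈p = x , x∈p , only-x
  where
  only-x : ∀ {y} → y ∈ p → y ≡ x
  only-x {y} y∈p with y ≟ x
  ... | yes y≡x = y≡x
  ... | no  y≢x = contradiction (∈-remove⁺ y∈p y≢x)
                    (∣p∣≡0⇒x∉p (suc-injective (trans (sym (x∈p⇒∣p∣≡1+∣p∩∁⁅x⁆∣ x∈p)) ∣p∣≡1)))

∣p∣≡2⇒pair : ∣ p ∣ ≡ 2 →
  ∃₂ λ x y → x ≢ y × x ∈ p × y ∈ p × (∀ {z} → z ∈ p → z ≡ x ⊎ z ≡ y)
∣p∣≡2⇒pair {p = p} ∣p∣≡2 with 0<∣p∣⇒Nonempty (≤-trans (s≤s z≤n) (≤-reflexive (sym ∣p∣≡2)))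
... | x , x∈p with ∣p∣≡1⇒singleton (suc-injective (trans (sym (x∈p⇒∣p∣≡1+∣p∩∁⁅x⁆∣ x∈p)) ∣p∣≡2))
...   | y , y∈rest , only-y =
  x , y , (λ x≡y → ∈-remove⁻ y∈rest (sym x≡y)) , x∈p , p∩q⊆p p _ y∈rest , x-or-y
  where
  x-or-y : ∀ {z} → z ∈ p → z ≡ x ⊎ z ≡ y
  x-or-y {z} z∈p with z ≟ x
  ... | yes z≡x = inj₁ z≡x
  ... | no  z≢x = inj₂ (only-y (∈-remove⁺ z∈p z≢x))

unique⇒∣p∣≤1 : (∀ {x y} → x ∈ p → y ∈ p → x ≡ y) → ∣ p ∣ ≤ 1
unique⇒∣p∣≤1 {p = p} unique with nonempty? p
... | no  empty     = ≤-trans (≤-reflexive (Empty⇒∣p∣≡0 empty)) z≤n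
... | yes (x , x∈p) = ≤-reflexive (trans (x∈p⇒∣p∣≡1+∣p∩∁⁅x⁆∣ x∈p) (cong suc (Empty⇒∣p∣≡0 rest-empty)))
  where
  rest-empty : Empty (p ∩ ∁ ⁅ x ⁆)
  rest-empty (y , y∈rest) = ∈-remove⁻ y∈rest (unique (p∩q⊆p p _ y∈rest) x∈p)

distinct⇒2≤∣p∣ : x ∈ p → y ∈ p → x ≢ y → 2 ≤ ∣ p ∣
distinct⇒2≤∣p∣ x∈p y∈p x≢y = ≤-trans (s≤s (x∈p⇒0<∣p∣ (∈-remove⁺ y∈p (λ y≡x → x≢y (sym y≡x)))))
  (≤-reflexive (sym (x∈p⇒∣p∣≡1+∣p∩∁⁅x⁆∣ x∈p)))

0<∣p∩q∣⇒∈ : ∀ (p q : Subset n) → 0 < ∣ p ∩ q ∣ → ∃[ x ] x ∈ p × x ∈ q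
0<∣p∩q∣⇒∈ p q 0<∣p∩q∣ = let x , x∈p∩q = 0<∣p∣⇒Nonempty 0<∣p∩q∣ in x , x∈p∩q⁻ p q x∈p∩q

∣Y∩S∣+∣Z∩T∣+k≤∣S∣+∣T∣ : ∀ {k} (Y Z S T : Subset n) → k ≤ ∣ S ∩ ∁ Y ∣ + ∣ T ∩ ∁ Z ∣ →
                          ∣ Y ∩ S ∣ + ∣ Z ∩ T ∣ + k ≤ ∣ S ∣ + ∣ T ∣
∣Y∩S∣+∣Z∩T∣+k≤∣S∣+∣T∣ Y Z S T escaping = begin
  ∣ Y ∩ S ∣ + ∣ Z ∩ T ∣ + _                              ≤⟨ +-monoʳ-≤ _ escaping ⟩
  ∣ Y ∩ S ∣ + ∣ Z ∩ T ∣ + (∣ S ∩ ∁ Y ∣ + ∣ T ∩ ∁ Z ∣)    ≡⟨ interchange (∣ Y ∩ S ∣) (∣ Z ∩ T ∣) (∣ S ∩ ∁ Y ∣) _ ⟩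
  ∣ Y ∩ S ∣ + ∣ S ∩ ∁ Y ∣ + (∣ Z ∩ T ∣ + ∣ T ∩ ∁ Z ∣)    ≡⟨ cong₂ (λ u v → ∣ u ∣ + ∣ S ∩ ∁ Y ∣ + (∣ v ∣ + ∣ T ∩ ∁ Z ∣))
                                                              (∩-comm Y S) (∩-comm Z T) ⟩
  ∣ S ∩ Y ∣ + ∣ S ∩ ∁ Y ∣ + (∣ T ∩ Z ∣ + ∣ T ∩ ∁ Z ∣)    ≡⟨ cong₂ _+_ (∣p∣≡∣p∩q∣+∣p∩∁q∣ S Y) (∣p∣≡∣p∩q∣+∣p∩∁q∣ T Z) ⟨
  ∣ S ∣ + ∣ T ∣                                          ∎
  where open ≤-Reasoning

x∉p⇒∣p∪⁅x⁆∣≡1+∣p∣ : x ∉ p → ∣ p ∪ ⁅ x ⁆ ∣ ≡ suc ∣ p ∣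
x∉p⇒∣p∪⁅x⁆∣≡1+∣p∣ {x = x} {p = p} x∉p = trans (∣p∪q∣≡∣p∣+∣∁p∩q∣ p ⁅ x ⁆)
  (trans (cong (∣ p ∣ +_) (x∈p⇒∣p∩⁅x⁆∣≡1 (x∉p⇒x∈∁p x∉p))) (+-comm ∣ p ∣ 1))

Nᴬ : BiGraph n → Fin n → Subset n
Nᴬ G a = tabulate (G a)

Nᴮ : BiGraph n → Fin n → Subset n
Nᴮ G b = tabulate (λ a → G a b)

transpose : BiGraph n → BiGraph n
transpose G b a = G a b

transpose-matching : {M : BiGraph n} → IsMatching M → IsMatching (transpose M)
transpose-matching (unique-right , unique-left) =
  (λ b a a′ → unique-left a a′ b) , (λ b b′ a → unique-right a b b′)

Complete : BiGraph n → Subset n → Subset n → Set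
Complete G Q P = ∀ {a b} → a ∈ Q → b ∈ P → Edge G a b

∈-tabulate⁺ : ∀ (f : Fin n → Bool) {x} → f x ≡ true → x ∈ tabulate f
∈-tabulate⁺ f {x} fx = lookup⇒[]= x (tabulate f) (trans (lookup∘tabulate f x) fx)

∈-tabulate⁻ : ∀ (f : Fin n → Bool) {x} → x ∈ tabulate f → f x ≡ true
∈-tabulate⁻ f {x} x∈ = trans (sym (lookup∘tabulate f x)) ([]=⇒lookup x∈)

∈Nᴬ⁺ : ∀ (G : BiGraph n) {x y} → Edge G x y → y ∈ Nᴬ G x
∈Nᴬ⁺ G {x} = ∈-tabulate⁺ (G x)

∈Nᴬ⁻ : ∀ (G : BiGraph n) {x y} → y ∈ Nᴬ G x → Edge G x y
∈Nᴬ⁻ G {x} = ∈-tabulate⁻ (G x)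

∈Nᴮ⁺ : ∀ (G : BiGraph n) {x y} → Edge G x y → x ∈ Nᴮ G y
∈Nᴮ⁺ G = ∈Nᴬ⁺ (transpose G)

∈Nᴮ⁻ : ∀ (G : BiGraph n) {x y} → x ∈ Nᴮ G y → Edge G x y
∈Nᴮ⁻ G = ∈Nᴬ⁻ (transpose G)

anyFin⁺ : ∀ (f : Fin n → Bool) i → f i ≡ true → anyFin f ≡ true
anyFin⁺ f zero    fi = cong (_∨ anyFin (λ j → f (suc j))) fi
anyFin⁺ f (suc i) fi = trans (cong (f zero ∨_) (anyFin⁺ (λ j → f (suc j)) i fi)) (∨-zeroʳ (f zero))

anyFin⁻ : ∀ (f : Fin n → Bool) → anyFin f ≡ true → ∃[ i ] f i ≡ true
anyFin⁻ {suc n} f any with f zero in f0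
... | true  = zero , f0
... | false with anyFin⁻ (λ j → f (suc j)) any
...   | i , fi = suc i , fi

module _ (G : BiGraph n) where

  ∈N⁺ : ∀ {X x y} → x ∈ X → Edge G x y → y ∈ N G X
  ∈N⁺ {X} {x} {y} x∈X e = ∈-tabulate⁺ (λ b → anyFin (λ a → lookup X a ∧ G a b))
    (anyFin⁺ (λ a → lookup X a ∧ G a y) x (cong₂ _∧_ ([]=⇒lookup x∈X) e))

  ∈N⁻ : ∀ X {y} → y ∈ N G X → ∃[ x ] x ∈ X × Edge G x y
  ∈N⁻ X {y} y∈N
    with anyFin⁻ (λ a → lookup X a ∧ G a y) (∈-tabulate⁻ (λ b → anyFin (λ a → lookup X a ∧ G a b)) y∈N)
  ... | x , both = x , lookup⇒[]= x X (∧-conicalˡ _ _ both) , ∧-conicalʳ _ _ both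

  Nᴬ⊆N : ∀ {X x} → x ∈ X → Nᴬ G x ⊆ N G X
  Nᴬ⊆N x∈X y∈ = ∈N⁺ x∈X (∈Nᴬ⁻ G y∈)

  ∉N⇒Nᴮ⊆∁ : ∀ X {y} → y ∉ N G X → Nᴮ G y ⊆ ∁ X
  ∉N⇒Nᴮ⊆∁ X y∉N x∈ = x∉p⇒x∈∁p (λ x∈X → y∉N (∈N⁺ x∈X (∈Nᴮ⁻ G x∈)))

  N-mono : ∀ {X X′} → X ⊆ X′ → N G X ⊆ N G X′
  N-mono {X} X⊆X′ y∈N with ∈N⁻ X y∈N
  ... | x , x∈X , e = ∈N⁺ (X⊆X′ x∈X) e

  N-∪⊆ : ∀ X X′ → N G (X ∪ X′) ⊆ N G X ∪ N G X′
  N-∪⊆ X X′ y∈N with ∈N⁻ (X ∪ X′) y∈N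
  ... | x , x∈X∪X′ , e with x∈p∪q⁻ X X′ x∈X∪X′
  ...   | inj₁ x∈X  = x∈p∪q⁺ (inj₁ (∈N⁺ x∈X e))
  ...   | inj₂ x∈X′ = x∈p∪q⁺ (inj₂ (∈N⁺ x∈X′ e))

  N-∪⁅⁆ : ∀ X a → N G (X ∪ ⁅ a ⁆) ≡ N G X ∪ Nᴬ G a
  N-∪⁅⁆ X a = ⊆-antisym to from
    where
    to : N G (X ∪ ⁅ a ⁆) ⊆ N G X ∪ Nᴬ G a
    to y∈N with x∈p∪q⁻ (N G X) (N G ⁅ a ⁆) (N-∪⊆ X ⁅ a ⁆ y∈N)
    ... | inj₁ y∈NX = x∈p∪q⁺ (inj₁ y∈NX)
    ... | inj₂ y∈Na with ∈N⁻ ⁅ a ⁆ y∈Na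
    ...   | x , x∈⁅a⁆ , e rewrite x∈⁅y⁆⇒x≡y a x∈⁅a⁆ = x∈p∪q⁺ (inj₂ (∈Nᴬ⁺ G e))
    from : N G X ∪ Nᴬ G a ⊆ N G (X ∪ ⁅ a ⁆)
    from y∈ with x∈p∪q⁻ (N G X) (Nᴬ G a) y∈
    ... | inj₁ y∈NX = N-mono {X} (p⊆p∪q ⁅ a ⁆) y∈NX
    ... | inj₂ y∈Na = ∈N⁺ (q⊆p∪q X ⁅ a ⁆ (x∈⁅x⁆ a)) (∈Nᴬ⁻ G y∈Na)

∣N[X∪⁅a⁆]∣ : ∀ (G : BiGraph n) X a → ∣ N G (X ∪ ⁅ a ⁆) ∣ ≡ ∣ N G X ∣ + ∣ ∁ (N G X) ∩ Nᴬ G a ∣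
∣N[X∪⁅a⁆]∣ G X a = trans (cong ∣_∣ (N-∪⁅⁆ G X a)) (∣p∪q∣≡∣p∣+∣∁p∩q∣ (N G X) (Nᴬ G a))

N-cong-rows : ∀ {G G′ : BiGraph n} X → (∀ {x} → x ∈ X → ∀ y → G x y ≡ G′ x y) → N G X ≡ N G′ X
N-cong-rows X same = ⊆-antisym (transfer same) (transfer λ x∈X y → sym (same x∈X y))
  where
  transfer : ∀ {G₁ G₂ : BiGraph _} → (∀ {x} → x ∈ X → ∀ y → G₁ x y ≡ G₂ x y) → N G₁ X ⊆ N G₂ X
  transfer {G₁} {G₂} same₁₂ y∈N with ∈N⁻ G₁ X y∈N
  ... | x , x∈X , e = ∈N⁺ G₂ x∈X (trans (sym (same₁₂ x∈X _)) e)

delEdge-⊆ : ∀ (G : BiGraph n) a b {x y} → Edge (delEdge G a b) x y → Edge G x y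
delEdge-⊆ G a b = ∧-conicalˡ _ _

delEdge-removes : ∀ (G : BiGraph n) a b → ¬ Edge (delEdge G a b) a b
delEdge-removes G a b e = contradiction (trans (sym e) removed) λ ()
  where
  removed : delEdge G a b a b ≡ false
  removed rewrite dec-true (a ≟ a) refl | dec-true (b ≟ b) refl = ∧-zeroʳ (G a b)

delEdge-other-row : ∀ (G : BiGraph n) {a} b {x} → a ≢ x → ∀ y → delEdge G a b x y ≡ G x y
delEdge-other-row G {a} b {x} a≢x y rewrite dec-false (a ≟ x) a≢x = ∧-identityʳ (G x y)

-- Hall's theorem

HallCondition : BiGraph n → Subset n → Subset n → Set
HallCondition G S T = ∀ {U} → U ⊆ S → ∣ U ∣ ≤ ∣ N G U ∩ T ∣

Matches : BiGraph n → Subset n → Subset n → (Fin n → Fin n) → Set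
Matches G S T σ =
  (∀ {a} → a ∈ S → σ a ∈ T × Edge G a (σ a)) ×
  (∀ {a a′} → a ∈ S → a′ ∈ S → σ a ≡ σ a′ → a ≡ a′)

splice : Subset n → (Fin n → Fin n) → (Fin n → Fin n) → Fin n → Fin n
splice U σ₁ σ₂ a with a ∈? U
... | yes _ = σ₁ a
... | no  _ = σ₂ a

module Hall (G : BiGraph n) where

  Matches-mono : ∀ {S S′ T T′ σ} → S′ ⊆ S → T ⊆ T′ → Matches G S T σ → Matches G S′ T′ σ
  Matches-mono S′⊆S T⊆T′ (into , injective) =
    (λ a∈S′ → map₁ T⊆T′ (into (S′⊆S a∈S′))) , (λ a∈S′ a′∈S′ → injective (S′⊆S a∈S′) (S′⊆S a′∈S′))

  vacuous : ∀ {S T} σ → Empty S → Matches G S T σ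
  vacuous σ empty = (λ a∈S → ⊥-elim (empty (_ , a∈S))) , (λ a∈S _ _ → ⊥-elim (empty (_ , a∈S)))

  splice-matches : ∀ {S T₁ T₂ σ₁ σ₂} U → Matches G (S ∩ U) T₁ σ₁ → Matches G (S ∩ ∁ U) T₂ σ₂ →
                   T₁ ⊆ ∁ T₂ → Matches G S (T₁ ∪ T₂) (splice U σ₁ σ₂)
  splice-matches {S} {T₁} {T₂} {σ₁} {σ₂} U (into₁ , injective₁) (into₂ , injective₂) T₁⊆∁T₂ =
    into , injective
    where
    into : ∀ {a} → a ∈ S → splice U σ₁ σ₂ a ∈ T₁ ∪ T₂ × Edge G a (splice U σ₁ σ₂ a)
    into {a} a∈S with a ∈? U
    ... | yes a∈U = map₁ (λ b∈ → x∈p∪q⁺ (inj₁ b∈)) (into₁ (x∈p∩q⁺ (a∈S , a∈U)))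
    ... | no  a∉U = map₁ (λ b∈ → x∈p∪q⁺ (inj₂ b∈)) (into₂ (x∈p∩q⁺ (a∈S , x∉p⇒x∈∁p a∉U)))
    separated : ∀ {a a′} → a ∈ S ∩ U → a′ ∈ S ∩ ∁ U → σ₁ a ≢ σ₂ a′
    separated a∈ a′∈ eq =
      x∈∁p⇒x∉p (T₁⊆∁T₂ (proj₁ (into₁ a∈))) (subst (_∈ T₂) (sym eq) (proj₁ (into₂ a′∈)))
    injective : ∀ {a a′} → a ∈ S → a′ ∈ S → splice U σ₁ σ₂ a ≡ splice U σ₁ σ₂ a′ → a ≡ a′
    injective {a} {a′} a∈S a′∈S eq with a ∈? U | a′ ∈? U
    ... | yes a∈U | yes a′∈U = injective₁ (x∈p∩q⁺ (a∈S , a∈U)) (x∈p∩q⁺ (a′∈S , a′∈U)) eq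
    ... | no  a∉U | no  a′∉U =
      injective₂ (x∈p∩q⁺ (a∈S , x∉p⇒x∈∁p a∉U)) (x∈p∩q⁺ (a′∈S , x∉p⇒x∈∁p a′∉U)) eq
    ... | yes a∈U | no  a′∉U =
      ⊥-elim (separated (x∈p∩q⁺ (a∈S , a∈U)) (x∈p∩q⁺ (a′∈S , x∉p⇒x∈∁p a′∉U)) eq)
    ... | no  a∉U | yes a′∈U =
      ⊥-elim (separated (x∈p∩q⁺ (a′∈S , a′∈U)) (x∈p∩q⁺ (a∈S , x∉p⇒x∈∁p a∉U)) (sym eq))

  -- Halmos–Vaughan: if some nonempty U ⊂ S is critical, match U into N G U ∩ T
  -- and S ∖ U into T ∖ N G U separately; otherwise every such U has surplus
  -- neighbours, so any edge a₀ b₀ can be put into the matching.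
  Critical : Subset n → Subset n → Subset n → Set
  Critical S T U = U ⊂ S × Nonempty U × ∣ N G U ∩ T ∣ ≤ ∣ U ∣

  HallBelow : Subset n → Set
  HallBelow S = ∀ {S′ T′} → ∣ S′ ∣ < ∣ S ∣ → HallCondition G S′ T′ → ∃ (Matches G S′ T′)

  critical-step : ∀ {S T U} → HallBelow S → HallCondition G S T → Critical S T U → ∃ (Matches G S T)
  critical-step {S} {T} {U} hall-below hall-S (U⊂S@(U⊆S , _) , (u , u∈U) , tight) =
    splice U σ₁ σ₂ ,
    Matches-mono ⊆-refl glued⊆T (splice-matches U (Matches-mono (p∩q⊆q S U) ⊆-refl matches₁) matches₂ separated)
    where
    NU = N G U

    hall-U : HallCondition G U (NU ∩ T)
    hall-U {V} V⊆U = ≤-trans (hall-S (⊆-trans V⊆U U⊆S)) (p⊆q⇒∣p∣≤∣q∣ λ b∈ →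
      let b∈NV , b∈T = x∈p∩q⁻ (N G V) T b∈ in x∈p∩q⁺ (b∈NV , x∈p∩q⁺ (N-mono G V⊆U b∈NV , b∈T)))

    hall-rest : HallCondition G (S ∩ ∁ U) (T ∩ ∁ NU)
    hall-rest {V} V⊆S∖U = +-cancelˡ-≤ ∣ U ∣ _ _ (begin
      ∣ U ∣ + ∣ V ∣                            ≡⟨ ∣U∪V∣ ⟨
      ∣ U ∪ V ∣                                ≤⟨ hall-S U∪V⊆S ⟩
      ∣ N G (U ∪ V) ∩ T ∣                      ≤⟨ p⊆q⇒∣p∣≤∣q∣ neighbours ⟩
      ∣ (NU ∩ T) ∪ (N G V ∩ (T ∩ ∁ NU)) ∣      ≤⟨ ∣p∪q∣≤∣p∣+∣q∣ (NU ∩ T) _ ⟩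
      ∣ NU ∩ T ∣ + ∣ N G V ∩ (T ∩ ∁ NU) ∣      ≤⟨ +-monoˡ-≤ _ tight ⟩
      ∣ U ∣ + ∣ N G V ∩ (T ∩ ∁ NU) ∣           ∎)
      where
      open ≤-Reasoning
      V⊆∁U : V ⊆ ∁ U
      V⊆∁U v∈V = p∩q⊆q S (∁ U) (V⊆S∖U v∈V)
      ∣U∪V∣ : ∣ U ∪ V ∣ ≡ ∣ U ∣ + ∣ V ∣
      ∣U∪V∣ = trans (∣p∪q∣≡∣p∣+∣∁p∩q∣ U V) (cong (λ W → ∣ U ∣ + ∣ W ∣) (p⊆q⇒q∩p≡p V⊆∁U))
      U∪V⊆S : U ∪ V ⊆ S
      U∪V⊆S a∈ with x∈p∪q⁻ U V a∈
      ... | inj₁ a∈U = U⊆S a∈U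
      ... | inj₂ a∈V = p∩q⊆p S (∁ U) (V⊆S∖U a∈V)
      neighbours : N G (U ∪ V) ∩ T ⊆ (NU ∩ T) ∪ (N G V ∩ (T ∩ ∁ NU))
      neighbours {b} b∈ with x∈p∩q⁻ (N G (U ∪ V)) T b∈
      ... | b∈N , b∈T with b ∈? NU | x∈p∪q⁻ NU (N G V) (N-∪⊆ G U V b∈N)
      ...   | yes b∈NU | _         = x∈p∪q⁺ (inj₁ (x∈p∩q⁺ (b∈NU , b∈T)))
      ...   | no  b∉NU | inj₁ b∈NU = contradiction b∈NU b∉NU
      ...   | no  b∉NU | inj₂ b∈NV = x∈p∪q⁺ (inj₂ (x∈p∩q⁺ (b∈NV , x∈p∩q⁺ (b∈T , x∉p⇒x∈∁p b∉NU))))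

    matching-U = hall-below (p⊂q⇒∣p∣<∣q∣ U⊂S) hall-U
    σ₁ = proj₁ matching-U
    matches₁ = proj₂ matching-U

    ∣S∖U∣<∣S∣ : ∣ S ∩ ∁ U ∣ < ∣ S ∣
    ∣S∖U∣<∣S∣ = ≤-trans (+-monoˡ-≤ ∣ S ∩ ∁ U ∣ (x∈p⇒0<∣p∣ (x∈p∩q⁺ (U⊆S u∈U , u∈U))))
                        (≤-reflexive (sym (∣p∣≡∣p∩q∣+∣p∩∁q∣ S U)))

    matching-rest = hall-below ∣S∖U∣<∣S∣ hall-rest
    σ₂ = proj₁ matching-rest
    matches₂ = proj₂ matching-rest

    separated : NU ∩ T ⊆ ∁ (T ∩ ∁ NU)
    separated b∈ = x∉p⇒x∈∁p λ b∈T∖NU →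
      x∈p⇒x∉∁p (proj₁ (x∈p∩q⁻ NU T b∈)) (proj₂ (x∈p∩q⁻ T (∁ NU) b∈T∖NU))

    glued⊆T : (NU ∩ T) ∪ (T ∩ ∁ NU) ⊆ T
    glued⊆T b∈ with x∈p∪q⁻ (NU ∩ T) (T ∩ ∁ NU) b∈
    ... | inj₁ b∈₁ = p∩q⊆q NU T b∈₁
    ... | inj₂ b∈₂ = p∩q⊆p T (∁ NU) b∈₂

  noncritical-step : ∀ {S T} → HallBelow S → HallCondition G S T → (∀ U → ¬ Critical S T U) →
                     ∃ (Matches G S T)
  noncritical-step {S} {T} hall-below hall-S no-critical with nonempty? S
  ... | no  empty          = id , vacuous id empty
  ... | yes (a₀ , a₀∈S) =
    splice ⁅ a₀ ⁆ (const b₀) σ₂ ,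
    Matches-mono ⊆-refl glued⊆T (splice-matches ⁅ a₀ ⁆ matches₁ matches₂ separated)
    where
    a₀-neighbour : Nonempty (N G ⁅ a₀ ⁆ ∩ T)
    a₀-neighbour = 0<∣p∣⇒Nonempty (≤-trans (≤-reflexive (sym (∣⁅x⁆∣≡1 a₀)))
      (hall-S λ a∈⁅a₀⁆ → subst (_∈ S) (sym (x∈⁅y⁆⇒x≡y a₀ a∈⁅a₀⁆)) a₀∈S))
    b₀ = proj₁ a₀-neighbour
    b₀∈T = proj₂ (x∈p∩q⁻ (N G ⁅ a₀ ⁆) T (proj₂ a₀-neighbour))

    a₀b₀ : Edge G a₀ b₀
    a₀b₀ with ∈N⁻ G ⁅ a₀ ⁆ (proj₁ (x∈p∩q⁻ (N G ⁅ a₀ ⁆) T (proj₂ a₀-neighbour)))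
    ... | a , a∈⁅a₀⁆ , e = subst (λ a → Edge G a b₀) (x∈⁅y⁆⇒x≡y a₀ a∈⁅a₀⁆) e

    matches₁ : Matches G (S ∩ ⁅ a₀ ⁆) ⁅ b₀ ⁆ (const b₀)
    matches₁ = (λ a∈ → x∈⁅x⁆ b₀ , subst (λ a → Edge G a b₀) (sym (is-a₀ a∈)) a₀b₀) ,
               (λ a∈ a′∈ _ → trans (is-a₀ a∈) (sym (is-a₀ a′∈)))
      where
      is-a₀ : ∀ {a} → a ∈ S ∩ ⁅ a₀ ⁆ → a ≡ a₀
      is-a₀ a∈ = x∈⁅y⁆⇒x≡y a₀ (p∩q⊆q S ⁅ a₀ ⁆ a∈)

    hall-rest : HallCondition G (S ∩ ∁ ⁅ a₀ ⁆) (T ∩ ∁ ⁅ b₀ ⁆)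
    hall-rest {V} V⊆S-a₀ with nonempty? V
    ... | no  empty       = ≤-trans (≤-reflexive (Empty⇒∣p∣≡0 empty)) z≤n
    ... | yes V-nonempty  = ≤-pred (begin-strict
      ∣ V ∣                                <⟨ ≰⇒> (λ loose → no-critical V (V⊂S , V-nonempty , loose)) ⟩
      ∣ N G V ∩ T ∣                        ≤⟨ ∣p∣≤1+∣p∩∁⁅x⁆∣ (N G V ∩ T) b₀ ⟩
      suc ∣ (N G V ∩ T) ∩ ∁ ⁅ b₀ ⁆ ∣       ≡⟨ cong (λ W → suc ∣ W ∣) (∩-assoc (N G V) T (∁ ⁅ b₀ ⁆)) ⟩
      suc ∣ N G V ∩ (T ∩ ∁ ⁅ b₀ ⁆) ∣       ∎)
      where
      open ≤-Reasoning
      a₀∉V : a₀ ∉ V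
      a₀∉V a₀∈V = ∈-remove⁻ (V⊆S-a₀ a₀∈V) refl
      V⊂S : V ⊂ S
      V⊂S = (λ a∈V → p∩q⊆p S _ (V⊆S-a₀ a∈V)) , a₀ , a₀∈S , a₀∉V

    ∣S-a₀∣<∣S∣ : ∣ S ∩ ∁ ⁅ a₀ ⁆ ∣ < ∣ S ∣
    ∣S-a₀∣<∣S∣ = ≤-reflexive (sym (x∈p⇒∣p∣≡1+∣p∩∁⁅x⁆∣ a₀∈S))

    matching-rest = hall-below ∣S-a₀∣<∣S∣ hall-rest
    σ₂ = proj₁ matching-rest
    matches₂ = proj₂ matching-rest

    separated : ⁅ b₀ ⁆ ⊆ ∁ (T ∩ ∁ ⁅ b₀ ⁆)
    separated b∈⁅b₀⁆ = x∉p⇒x∈∁p λ b∈T-b₀ → ∈-remove⁻ b∈T-b₀ (x∈⁅y⁆⇒x≡y b₀ b∈⁅b₀⁆)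

    glued⊆T : ⁅ b₀ ⁆ ∪ (T ∩ ∁ ⁅ b₀ ⁆) ⊆ T
    glued⊆T b∈ with x∈p∪q⁻ ⁅ b₀ ⁆ (T ∩ ∁ ⁅ b₀ ⁆) b∈
    ... | inj₁ b∈⁅b₀⁆ = subst (_∈ T) (sym (x∈⁅y⁆⇒x≡y b₀ b∈⁅b₀⁆)) b₀∈T
    ... | inj₂ b∈T-b₀ = p∩q⊆p T _ b∈T-b₀

  critical? : ∀ S T → Dec (∃ (Critical S T))
  critical? S T = anySubset? (λ U → U ⊂? S ×-dec nonempty? U ×-dec ∣ N G U ∩ T ∣ ≤? ∣ U ∣)

  hall-below : ∀ k S → ∣ S ∣ ≤ suc k → HallBelow S

  hall⇒matches : ∀ k {S T} → ∣ S ∣ ≤ k → HallCondition G S T → ∃ (Matches G S T)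
  hall⇒matches zero    ∣S∣≤0 _ = id , vacuous id λ (a , a∈S) → ∣p∣≡0⇒x∉p (n≤0⇒n≡0 ∣S∣≤0) a∈S
  hall⇒matches (suc k) {S} {T} ∣S∣≤1+k hall-S with critical? S T
  ... | yes (U , critical) = critical-step (hall-below k S ∣S∣≤1+k) hall-S critical
  ... | no  none = noncritical-step (hall-below k S ∣S∣≤1+k) hall-S (λ U critical → none (U , critical))

  hall-below k S ∣S∣≤1+k smaller = hall⇒matches k (≤-pred (≤-trans smaller ∣S∣≤1+k))

no-obstruction⇒one-factor : ∀ (G : BiGraph n) → (∀ Y → ¬ IsObstruction G Y) → HasOneFactor G
no-obstruction⇒one-factor {n} G no-obstruction =
  let σ , into , injective = Hall.hall⇒matches G n (∣p∣≤n ⊤) ⊤-condition in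
  σ , injective ∈⊤ ∈⊤ , λ a → proj₂ (into ∈⊤)
  where
  ⊤-condition : HallCondition G ⊤ ⊤
  ⊤-condition {U} _ = subst (∣ U ∣ ≤_) (cong ∣_∣ (sym (∩-identityʳ (N G U)))) (≮⇒≥ (no-obstruction U))

-- The graph H around an obstruction

module _ {H : BiGraph n} {t : ℕ} (H-bigraph : IsBigraph n t H) where

  complete-onto-N : ∀ {X} → ∣ N H X ∣ ≤ t → Complete H X (N H X)
  complete-onto-N ∣NX∣≤t {a} a∈X b∈NX =
    ∈Nᴬ⁻ H (p⊆q∧∣q∣≤∣p∣⇒q⊆p (Nᴬ⊆N H a∈X) (≤-trans ∣NX∣≤t (proj₁ H-bigraph a)) b∈NX)

  complete-off-N : ∀ {X} → ∣ ∁ X ∣ ≤ t → Complete H (∁ X) (∁ (N H X))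
  complete-off-N {X} ∣∁X∣≤t {a} {b} a∈∁X b∈∁NX =
    ∈Nᴮ⁻ H (p⊆q∧∣q∣≤∣p∣⇒q⊆p (∉N⇒Nᴮ⊆∁ H X (x∈∁p⇒x∉p b∈∁NX)) (≤-trans ∣∁X∣≤t (proj₂ H-bigraph b)) a∈∁X)

  degree-into-N : ∀ {X a} → a ∈ X → t ≤ ∣ N H X ∩ Nᴬ H a ∣
  degree-into-N a∈X = ≤-trans (proj₁ H-bigraph _) (p⊆q⇒∣p∣≤∣q∣ λ b∈Na → x∈p∩q⁺ (Nᴬ⊆N H a∈X b∈Na , b∈Na))

  degree-off-N : ∀ {X b} → b ∈ ∁ (N H X) → t ≤ ∣ ∁ X ∩ Nᴮ H b ∣
  degree-off-N {X} b∈∁NX = ≤-trans (proj₂ H-bigraph _)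
    (p⊆q⇒∣p∣≤∣q∣ λ a∈Nb → x∈p∩q⁺ (∉N⇒Nᴮ⊆∁ H X (x∈∁p⇒x∉p b∈∁NX) a∈Nb , a∈Nb))

Type123Extension : BiGraph n → Subset n → Set
Type123Extension H X = ∃[ Y ] X ⊆ Y × IsObstruction H Y × (Type1 H Y ⊎ Type2 H Y ⊎ Type3 H Y)

type1⇒obstruction : ∀ {H : BiGraph n} {X} → Type1 H X → IsObstruction H X
type1⇒obstruction (∣X∣≡5 , ∣NX∣≡3) = subst₂ _<_ (sym ∣NX∣≡3) (sym ∣X∣≡5) (m≤n⇒m≤1+n ≤-refl)

type2⇒obstruction : ∀ {H : BiGraph n} {X} → Type2 H X → IsObstruction H X
type2⇒obstruction (_ , _ , ∣X∣≡4 , ∣NX∣≡3 , _) = subst₂ _<_ (sym ∣NX∣≡3) (sym ∣X∣≡4) ≤-refl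

type3⇒obstruction : ∀ {H : BiGraph n} {X} → Type3 H X → IsObstruction H X
type3⇒obstruction (_ , _ , _ , ∣X∣≡4 , ∣NX∣≡3 , _) = subst₂ _<_ (sym ∣NX∣≡3) (sym ∣X∣≡4) ≤-refl

module OuterNeighbours {H : BiGraph n} {X : Subset n} {a : Fin n} (a∉X : a ∉ X) where

  C D : Subset n
  C = N H X
  D = ∁ C ∩ Nᴬ H a

  D-edge : ∀ {b} → b ∈ D → Edge H a b
  D-edge b∈D = ∈Nᴬ⁻ H (proj₂ (x∈p∩q⁻ (∁ C) (Nᴬ H a) b∈D))

  a≢ : ∀ {x} → x ∈ X → a ≢ x
  a≢ x∈X a≡x = a∉X (subst (_∈ X) (sym a≡x) x∈X)

  ∣N[X∪⁅a⁆]∣≡∣C∣ : ∀ {G} → (∀ {x} → x ∈ X → ∀ y → G x y ≡ H x y) → (∀ {b} → Edge G a b → Edge H a b) →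
                   (∀ {b} → b ∈ D → ¬ Edge G a b) → ∣ N G (X ∪ ⁅ a ⁆) ∣ ≡ ∣ C ∣
  ∣N[X∪⁅a⁆]∣≡∣C∣ {G} same-rows G⊆H pruned = begin
    ∣ N G (X ∪ ⁅ a ⁆) ∣               ≡⟨ ∣N[X∪⁅a⁆]∣ G X a ⟩
    ∣ N G X ∣ + ∣ ∁ (N G X) ∩ Nᴬ G a ∣ ≡⟨ cong (λ W → ∣ W ∣ + ∣ ∁ W ∩ Nᴬ G a ∣) (N-cong-rows X same-rows) ⟩
    ∣ C ∣ + ∣ ∁ C ∩ Nᴬ G a ∣           ≡⟨ cong (∣ C ∣ +_) (Empty⇒∣p∣≡0 no-outer) ⟩
    ∣ C ∣ + 0                          ≡⟨ +-identityʳ ∣ C ∣ ⟩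
    ∣ C ∣                              ∎
    where
    open ≡-Reasoning
    no-outer : Empty (∁ C ∩ Nᴬ G a)
    no-outer (b , b∈) = let b∈∁C , b∈Na = x∈p∩q⁻ (∁ C) (Nᴬ G a) b∈ in
      pruned (x∈p∩q⁺ (b∈∁C , ∈Nᴬ⁺ H (G⊆H (∈Nᴬ⁻ G b∈Na)))) (∈Nᴬ⁻ G b∈Na)

  module _ (∣X∣≡4 : ∣ X ∣ ≡ 4) (∣C∣≡3 : ∣ C ∣ ≡ 3) where

    ∣N[X∪⁅a⁆]∣≡3+∣D∣ : ∣ N H (X ∪ ⁅ a ⁆) ∣ ≡ 3 + ∣ D ∣
    ∣N[X∪⁅a⁆]∣≡3+∣D∣ = trans (∣N[X∪⁅a⁆]∣ H X a) (cong (_+ ∣ D ∣) ∣C∣≡3)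

    ∣D∣≡0⇒type1 : ∣ D ∣ ≡ 0 → Type1 H (X ∪ ⁅ a ⁆)
    ∣D∣≡0⇒type1 ∣D∣≡0 = trans (x∉p⇒∣p∪⁅x⁆∣≡1+∣p∣ a∉X) (cong suc ∣X∣≡4) , trans ∣N[X∪⁅a⁆]∣≡3+∣D∣ (cong (3 +_) ∣D∣≡0)

    ∣D∣≡1⇒type2 : ∣ D ∣ ≡ 1 → Type2 H X
    ∣D∣≡1⇒type2 ∣D∣≡1 with ∣p∣≡1⇒singleton ∣D∣≡1
    ... | b₁ , b₁∈D , only-b₁ =
      a , b₁ , ∣X∣≡4 , ∣C∣≡3 , a∉X , D-edge b₁∈D , trans ∣N[X∪⁅a⁆]∣≡3+∣D∣ (cong (3 +_) ∣D∣≡1) ,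
      trans (∣N[X∪⁅a⁆]∣≡∣C∣ rows (delEdge-⊆ H a b₁) pruned) ∣C∣≡3
      where
      rows : ∀ {x} → x ∈ X → ∀ y → delEdge H a b₁ x y ≡ H x y
      rows x∈X = delEdge-other-row H b₁ (a≢ x∈X)
      pruned : ∀ {b} → b ∈ D → ¬ Edge (delEdge H a b₁) a b
      pruned b∈D with only-b₁ b∈D
      ... | refl = delEdge-removes H a b₁

    ∣D∣≡2⇒type3 : ∣ D ∣ ≡ 2 → Type3 H X
    ∣D∣≡2⇒type3 ∣D∣≡2 with ∣p∣≡2⇒pair ∣D∣≡2
    ... | b₁ , b₂ , _ , b₁∈D , b₂∈D , b₁-or-b₂ =
      a , b₁ , b₂ , ∣X∣≡4 , ∣C∣≡3 , a∉X , D-edge b₁∈D , D-edge b₂∈D ,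
      trans ∣N[X∪⁅a⁆]∣≡3+∣D∣ (cong (3 +_) ∣D∣≡2) ,
      trans (∣N[X∪⁅a⁆]∣≡∣C∣ rows (λ e → delEdge-⊆ H a b₁ (delEdge-⊆ H₁ a b₂ e)) pruned) ∣C∣≡3
      where
      H₁ = delEdge H a b₁
      rows : ∀ {x} → x ∈ X → ∀ y → delEdge H₁ a b₂ x y ≡ H x y
      rows x∈X y = trans (delEdge-other-row H₁ b₂ (a≢ x∈X) y) (delEdge-other-row H b₁ (a≢ x∈X) y)
      pruned : ∀ {b} → b ∈ D → ¬ Edge (delEdge H₁ a b₂) a b
      pruned b∈D with b₁-or-b₂ b∈D
      ... | inj₁ refl = λ e → delEdge-removes H a b₁ (delEdge-⊆ H₁ a b₂ e)
      ... | inj₂ refl = delEdge-removes H₁ a b₂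

    few-outer-neighbours⇒extension : ∣ D ∣ ≤ 2 → Type123Extension H X
    few-outer-neighbours⇒extension = by-size ∣ D ∣ refl
      where
      by-size : ∀ k → ∣ D ∣ ≡ k → k ≤ 2 → Type123Extension H X
      by-size 0 ∣D∣≡0 _ = X ∪ ⁅ a ⁆ , p⊆p∪q ⁅ a ⁆ , type1⇒obstruction {H = H} {X ∪ ⁅ a ⁆} type1 , inj₁ type1
        where type1 = ∣D∣≡0⇒type1 ∣D∣≡0
      by-size 1 ∣D∣≡1 _ = X , ⊆-refl , type2⇒obstruction {H = H} {X} type2 , inj₂ (inj₁ type2)
        where type2 = ∣D∣≡1⇒type2 ∣D∣≡1
      by-size 2 ∣D∣≡2 _ = X , ⊆-refl , type3⇒obstruction {H = H} {X} type3 , inj₂ (inj₂ type3)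
        where type3 = ∣D∣≡2⇒type3 ∣D∣≡2
      by-size (suc (suc (suc _))) _ (s≤s (s≤s ()))

type4⇒outer-degree : ∀ {H : BiGraph n} {X} → Type4 H X → ∀ {a} → a ∉ X → 3 ≤ ∣ ∁ (N H X) ∩ Nᴬ H a ∣
type4⇒outer-degree (∣X∣≡4 , ∣C∣≡3 , maximal) a∉X = decidable-stable (3 ≤? _) λ 3≰∣D∣ →
  maximal (few-outer-neighbours⇒extension ∣X∣≡4 ∣C∣≡3 (≤-pred (≰⇒> 3≰∣D∣)))
  where open OuterNeighbours a∉X

-- Obstructions of H + M₁ - M₂

module CrossMatching {H M : BiGraph n} (M-matching : IsMatching M) {Y Z : Subset n}
                     (across : ∀ {a b} → a ∈ Y → b ∈ Z → Edge H a b → Edge M a b) where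

  ∣Z∩Nᴬ∣≤1 : ∀ {a} → a ∈ Y → ∣ Z ∩ Nᴬ H a ∣ ≤ 1
  ∣Z∩Nᴬ∣≤1 {a} a∈Y = unique⇒∣p∣≤1 λ b∈ b′∈ → proj₁ M-matching a _ _ (M-edge b∈) (M-edge b′∈)
    where
    M-edge : ∀ {b} → b ∈ Z ∩ Nᴬ H a → Edge M a b
    M-edge b∈ = let b∈Z , b∈Na = x∈p∩q⁻ Z (Nᴬ H a) b∈ in across a∈Y b∈Z (∈Nᴬ⁻ H b∈Na)

  ∣Z∩P∣+∣P∩Nᴬ∣≤∣P∣+1 : ∀ {a} → a ∈ Y → ∀ P → ∣ Z ∩ P ∣ + ∣ P ∩ Nᴬ H a ∣ ≤ ∣ P ∣ + 1
  ∣Z∩P∣+∣P∩Nᴬ∣≤∣P∣+1 {a} a∈Y P = begin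
    ∣ Z ∩ P ∣ + ∣ P ∩ Na ∣                               ≡⟨ cong (_+ ∣ P ∩ Na ∣) (∣p∣≡∣p∩q∣+∣p∩∁q∣ (Z ∩ P) Na) ⟩
    ∣ (Z ∩ P) ∩ Na ∣ + ∣ (Z ∩ P) ∩ ∁ Na ∣ + ∣ P ∩ Na ∣    ≤⟨ +-monoˡ-≤ _ (+-mono-≤ matched unmatched) ⟩
    1 + ∣ P ∩ ∁ Na ∣ + ∣ P ∩ Na ∣                        ≡⟨ cong suc (+-comm ∣ P ∩ ∁ Na ∣ ∣ P ∩ Na ∣) ⟩
    1 + (∣ P ∩ Na ∣ + ∣ P ∩ ∁ Na ∣)                      ≡⟨ cong suc (∣p∣≡∣p∩q∣+∣p∩∁q∣ P Na) ⟨
    1 + ∣ P ∣                                            ≡⟨ +-comm 1 ∣ P ∣ ⟩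
    ∣ P ∣ + 1                                            ∎
    where
    open ≤-Reasoning
    Na = Nᴬ H a
    matched : ∣ (Z ∩ P) ∩ Na ∣ ≤ 1
    matched = ≤-trans (p⊆q⇒∣p∣≤∣q∣ (∩-monoˡ (p∩q⊆p Z P) Na)) (∣Z∩Nᴬ∣≤1 a∈Y)
    unmatched : ∣ (Z ∩ P) ∩ ∁ Na ∣ ≤ ∣ P ∩ ∁ Na ∣
    unmatched = p⊆q⇒∣p∣≤∣q∣ (∩-monoˡ (p∩q⊆q Z P) (∁ Na))

module Perturbation {H M₁ M₂ : BiGraph n} (M₂-matching : IsMatching M₂) (Y : Subset n) where

  G : BiGraph n
  G = (H +E M₁) -E M₂

  Z : Subset n
  Z = ∁ (N G Y)

  H-across⇒M₂ : ∀ {a b} → a ∈ Y → b ∈ Z → Edge H a b → Edge M₂ a b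
  H-across⇒M₂ {a} {b} a∈Y b∈Z ab with M₂ a b in M₂ab
  ... | true  = refl
  ... | false = contradiction (∈N⁺ G a∈Y G-edge) (x∈∁p⇒x∉p b∈Z)
    where
    G-edge : Edge G a b
    G-edge rewrite ab | M₂ab = refl

  private
    module Z-side = CrossMatching M₂-matching H-across⇒M₂
    module Y-side = CrossMatching (transpose-matching M₂-matching) (λ b∈Z a∈Y → H-across⇒M₂ a∈Y b∈Z)

  complete-block : ∀ {Q P} → Complete H Q P →
                   (0 < ∣ Y ∩ Q ∣ → ∣ Z ∩ P ∣ ≤ 1) × (0 < ∣ Z ∩ P ∣ → ∣ Y ∩ Q ∣ ≤ 1)
  complete-block {Q} {P} complete =
    (λ 0<∣Y∩Q∣ → let a , a∈Y , a∈Q = 0<∣p∩q∣⇒∈ Y Q 0<∣Y∩Q∣ in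
       ≤-trans (p⊆q⇒∣p∣≤∣q∣ (∩-monoʳ Z λ b∈P → ∈Nᴬ⁺ H (complete a∈Q b∈P))) (Z-side.∣Z∩Nᴬ∣≤1 a∈Y)) ,
    (λ 0<∣Z∩P∣ → let b , b∈Z , b∈P = 0<∣p∩q∣⇒∈ Z P 0<∣Z∩P∣ in
       ≤-trans (p⊆q⇒∣p∣≤∣q∣ (∩-monoʳ Y λ a∈Q → ∈Nᴮ⁺ H (complete a∈Q b∈P))) (Y-side.∣Z∩Nᴬ∣≤1 b∈Z))

  degree-block-Z : ∀ {Q P d} → (∀ {a} → a ∈ Q → d ≤ ∣ P ∩ Nᴬ H a ∣) →
                   0 < ∣ Y ∩ Q ∣ → ∣ Z ∩ P ∣ + d ≤ ∣ P ∣ + 1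
  degree-block-Z {Q} {P} degree 0<∣Y∩Q∣ = let a , a∈Y , a∈Q = 0<∣p∩q∣⇒∈ Y Q 0<∣Y∩Q∣ in
    ≤-trans (+-monoʳ-≤ ∣ Z ∩ P ∣ (degree a∈Q)) (Z-side.∣Z∩P∣+∣P∩Nᴬ∣≤∣P∣+1 a∈Y P)

  degree-block-Y : ∀ {Q P d} → (∀ {b} → b ∈ P → d ≤ ∣ Q ∩ Nᴮ H b ∣) →
                   0 < ∣ Z ∩ P ∣ → ∣ Y ∩ Q ∣ + d ≤ ∣ Q ∣ + 1
  degree-block-Y {Q} {P} degree 0<∣Z∩P∣ = let b , b∈Z , b∈P = 0<∣p∩q∣⇒∈ Z P 0<∣Z∩P∣ in
    ≤-trans (+-monoʳ-≤ ∣ Y ∩ Q ∣ (degree b∈P)) (Y-side.∣Z∩P∣+∣P∩Nᴬ∣≤∣P∣+1 b∈Z Q)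

  violated⇒n<∣Y∣+∣Z∣ : IsObstruction G Y → n < ∣ Y ∣ + ∣ Z ∣
  violated⇒n<∣Y∣+∣Z∣ violated = begin-strict
    n                              ≡⟨ m+[n∸m]≡n (∣p∣≤n (N G Y)) ⟨
    ∣ N G Y ∣ + (n ∸ ∣ N G Y ∣)    <⟨ +-monoˡ-< (n ∸ ∣ N G Y ∣) violated ⟩
    ∣ Y ∣ + (n ∸ ∣ N G Y ∣)        ≡⟨ cong (∣ Y ∣ +_) (∣∁p∣≡n∸∣p∣ (N G Y)) ⟨
    ∣ Y ∣ + ∣ Z ∣                  ∎
    where open ≤-Reasoning

  0<∣Y∣⇒∣Z∣+t≤n : ∀ {t} → IsBigraph n t G → 0 < ∣ Y ∣ → ∣ Z ∣ + t ≤ n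
  0<∣Y∣⇒∣Z∣+t≤n G-bigraph 0<∣Y∣ =
    ≤-trans (+-monoʳ-≤ ∣ Z ∣ (proj₁ G-bigraph a)) (p⊆∁q⇒∣p∣+∣q∣≤n Z⊆∁Na)
    where
    Y-nonempty = 0<∣p∣⇒Nonempty {p = Y} 0<∣Y∣
    a = proj₁ Y-nonempty
    Z⊆∁Na : Z ⊆ ∁ (Nᴬ G a)
    Z⊆∁Na b∈Z = x∉p⇒x∈∁p λ b∈Na → x∈∁p⇒x∉p b∈Z (Nᴬ⊆N G (proj₂ Y-nonempty) b∈Na)

  0<∣Z∣⇒∣Y∣+t≤n : ∀ {t} → IsBigraph n t G → 0 < ∣ Z ∣ → ∣ Y ∣ + t ≤ n
  0<∣Z∣⇒∣Y∣+t≤n G-bigraph 0<∣Z∣ =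
    ≤-trans (+-monoʳ-≤ ∣ Y ∣ (proj₂ G-bigraph b)) (p⊆∁q⇒∣p∣+∣q∣≤n Y⊆∁Nb)
    where
    Z-nonempty = 0<∣p∣⇒Nonempty {p = Z} 0<∣Z∣
    b = proj₁ Z-nonempty
    Y⊆∁Nb : Y ⊆ ∁ (Nᴮ G b)
    Y⊆∁Nb a∈Y = x∉p⇒x∈∁p λ a∈Nb → x∈∁p⇒x∉p (proj₂ Z-nonempty) (∈N⁺ G a∈Y (∈Nᴮ⁻ G a∈Nb))

  obstruction-sizes : ∀ {t y z} → IsBigraph n t G → IsObstruction G Y → ∣ Y ∣ ≡ y → ∣ Z ∣ ≡ z →
                      n < y + z × (0 < y → z + t ≤ n) × (0 < z → y + t ≤ n)
  obstruction-sizes G-bigraph violated refl refl =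
    violated⇒n<∣Y∣+∣Z∣ violated , 0<∣Y∣⇒∣Z∣+t≤n G-bigraph , 0<∣Z∣⇒∣Y∣+t≤n G-bigraph

  edge-escapes : ∀ {a b} → Edge G a b → a ∈ ∁ Y ⊎ b ∈ ∁ Z
  edge-escapes {a} ab with a ∈? Y
  ... | yes a∈Y = inj₂ (x∉p⇒x∈∁p (x∈p⇒x∉∁p (∈N⁺ G a∈Y ab)))
  ... | no  a∉Y = inj₁ (x∉p⇒x∈∁p a∉Y)

  edge⇒∣Y∩S∣+∣Z∩T∣+1≤∣S∣+∣T∣ : ∀ {S T} → HasEdgeBetween G S T →
                                ∣ Y ∩ S ∣ + ∣ Z ∩ T ∣ + 1 ≤ ∣ S ∣ + ∣ T ∣
  edge⇒∣Y∩S∣+∣Z∩T∣+1≤∣S∣+∣T∣ {S} {T} (a , b , a∈S , b∈T , ab) = ∣Y∩S∣+∣Z∩T∣+k≤∣S∣+∣T∣ Y Z S T escaping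
    where
    escaping : 1 ≤ ∣ S ∩ ∁ Y ∣ + ∣ T ∩ ∁ Z ∣
    escaping with edge-escapes ab
    ... | inj₁ a∈∁Y = ≤-trans (x∈p⇒0<∣p∣ (x∈p∩q⁺ (a∈S , a∈∁Y))) (m≤m+n _ _)
    ... | inj₂ b∈∁Z = ≤-trans (x∈p⇒0<∣p∣ (x∈p∩q⁺ (b∈T , b∈∁Z))) (m≤n+m _ _)

  matching2⇒∣Y∩S∣+∣Z∩T∣+2≤∣S∣+∣T∣ : ∀ {S T} → HasMatching2 G S T →
                                     ∣ Y ∩ S ∣ + ∣ Z ∩ T ∣ + 2 ≤ ∣ S ∣ + ∣ T ∣
  matching2⇒∣Y∩S∣+∣Z∩T∣+2≤∣S∣+∣T∣ {S} {T}
    (_ , _ , _ , _ , a₁≢a₂ , b₁≢b₂ , a₁∈S , a₂∈S , b₁∈T , b₂∈T , e₁ , e₂) =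
    ∣Y∩S∣+∣Z∩T∣+k≤∣S∣+∣T∣ Y Z S T escaping
    where
    escaping : 2 ≤ ∣ S ∩ ∁ Y ∣ + ∣ T ∩ ∁ Z ∣
    escaping with edge-escapes e₁ | edge-escapes e₂
    ... | inj₁ a₁∈∁Y | inj₁ a₂∈∁Y = ≤-trans
      (distinct⇒2≤∣p∣ (x∈p∩q⁺ (a₁∈S , a₁∈∁Y)) (x∈p∩q⁺ (a₂∈S , a₂∈∁Y)) a₁≢a₂) (m≤m+n _ _)
    ... | inj₂ b₁∈∁Z | inj₂ b₂∈∁Z = ≤-trans
      (distinct⇒2≤∣p∣ (x∈p∩q⁺ (b₁∈T , b₁∈∁Z)) (x∈p∩q⁺ (b₂∈T , b₂∈∁Z)) b₁≢b₂) (m≤n+m _ _)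
    ... | inj₁ a₁∈∁Y | inj₂ b₂∈∁Z =
      +-mono-≤ (x∈p⇒0<∣p∣ (x∈p∩q⁺ (a₁∈S , a₁∈∁Y))) (x∈p⇒0<∣p∣ (x∈p∩q⁺ (b₂∈T , b₂∈∁Z)))
    ... | inj₂ b₁∈∁Z | inj₁ a₂∈∁Y =
      +-mono-≤ (x∈p⇒0<∣p∣ (x∈p∩q⁺ (a₂∈S , a₂∈∁Y))) (x∈p⇒0<∣p∣ (x∈p∩q⁺ (b₁∈T , b₁∈∁Z)))

-- Counting profiles

-- A profile records an obstruction Y of G and Z = ∁ (N G Y) by yᵢ = ∣ Y ∩ Aᵢ ∣
-- and zᵢ = ∣ Z ∩ Bᵢ ∣ for the parts A₁ = X, A₂ = ∁ X of A and B₁ = N H X,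
-- B₂ = ∁ (N H X) of B; for types 2 and 3 the parts A₀ = ⁅ x₁ ⁆ and
-- B₀ = N H (X ∪ ⁅ x₁ ⁆) ∖ N H X are split off A₂ and B₂. Each conjunct is one of
-- the inequalities above, and exhaustive search over the ranges allowed by the
-- part sizes shows that no profile exists.

Type1Profile : (y₁ y₂ z₁ z₂ : ℕ) → Set
Type1Profile y₁ y₂ z₁ z₂ =
  (0 < y₁ → z₁ ≤ 1) × (0 < z₁ → y₁ ≤ 1) ×
  (0 < y₂ → z₂ ≤ 1) × (0 < z₂ → y₂ ≤ 1) ×
  y₁ + z₂ + 2 ≤ 10 ×
  8 < y₁ + y₂ + (z₁ + z₂)

type1-profile? : ∀ y₁ y₂ z₁ z₂ → Dec (Type1Profile y₁ y₂ z₁ z₂)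
type1-profile? y₁ y₂ z₁ z₂ =
  (0 <? y₁ →-dec z₁ ≤? 1) ×-dec (0 <? z₁ →-dec y₁ ≤? 1) ×-dec
  (0 <? y₂ →-dec z₂ ≤? 1) ×-dec (0 <? z₂ →-dec y₂ ≤? 1) ×-dec
  _ ≤? 10 ×-dec
  8 <? _

no-type1-profile : ∀ {y₁} → y₁ < 6 → ∀ {y₂} → y₂ < 4 → ∀ {z₁} → z₁ < 4 → ∀ {z₂} → z₂ < 6 →
                   ¬ Type1Profile y₁ y₂ z₁ z₂
no-type1-profile = from-yes
  (allUpTo? (λ y₁ → allUpTo? (λ y₂ → allUpTo? (λ z₁ → allUpTo? (λ z₂ →
    ¬? (type1-profile? y₁ y₂ z₁ z₂)) 6) 4) 4) 6)

Type23Profile : (y₁ y₀ y₂ z₁ z₀ z₂ : ℕ) → Set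
Type23Profile y₁ y₀ y₂ z₁ z₀ z₂ =
  (0 < y₁ → z₁ ≤ 1) × (0 < z₁ → y₁ ≤ 1) ×
  (0 < y₂ → z₂ ≤ 1) × (0 < z₂ → y₂ ≤ 1) ×
  (0 < y₀ → z₁ + z₀ + 3 ≤ 6) ×
  z₀ + z₂ ≤ 5 ×
  y₁ + y₀ + (z₀ + z₂) + 2 ≤ 10 ×
  8 < y₁ + y₀ + y₂ + (z₁ + z₀ + z₂) ×
  (0 < y₁ + y₀ + y₂ → z₁ + z₀ + z₂ + 3 ≤ 8) × (0 < z₁ + z₀ + z₂ → y₁ + y₀ + y₂ + 3 ≤ 8)

type23-profile? : ∀ y₁ y₀ y₂ z₁ z₀ z₂ → Dec (Type23Profile y₁ y₀ y₂ z₁ z₀ z₂)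
type23-profile? y₁ y₀ y₂ z₁ z₀ z₂ =
  (0 <? y₁ →-dec z₁ ≤? 1) ×-dec (0 <? z₁ →-dec y₁ ≤? 1) ×-dec
  (0 <? y₂ →-dec z₂ ≤? 1) ×-dec (0 <? z₂ →-dec y₂ ≤? 1) ×-dec
  (0 <? y₀ →-dec _ ≤? 6) ×-dec
  _ ≤? 5 ×-dec
  _ ≤? 10 ×-dec
  8 <? _ ×-dec
  (0 <? _ →-dec _ ≤? 8) ×-dec (0 <? _ →-dec _ ≤? 8)

no-type23-profile : ∀ {y₁} → y₁ < 5 → ∀ {y₀} → y₀ < 2 → ∀ {y₂} → y₂ < 4 →
                    ∀ {z₁} → z₁ < 4 → ∀ {z₀} → z₀ < 3 → ∀ {z₂} → z₂ < 6 →
                    ¬ Type23Profile y₁ y₀ y₂ z₁ z₀ z₂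
no-type23-profile = from-yes
  (allUpTo? (λ y₁ → allUpTo? (λ y₀ → allUpTo? (λ y₂ → allUpTo? (λ z₁ → allUpTo? (λ z₀ → allUpTo? (λ z₂ →
    ¬? (type23-profile? y₁ y₀ y₂ z₁ z₀ z₂)) 6) 3) 4) 4) 2) 5)

Type4Profile : (y₁ y₂ z₁ z₂ : ℕ) → Set
Type4Profile y₁ y₂ z₁ z₂ =
  (0 < y₁ → z₁ ≤ 1) × (0 < z₁ → y₁ ≤ 1) ×
  (0 < y₂ → z₂ + 3 ≤ 6) × (0 < z₂ → y₂ + 3 ≤ 5) ×
  y₁ + z₂ + 1 ≤ 9 ×
  8 < y₁ + y₂ + (z₁ + z₂) ×
  (0 < y₁ + y₂ → z₁ + z₂ + 3 ≤ 8) × (0 < z₁ + z₂ → y₁ + y₂ + 3 ≤ 8)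

type4-profile? : ∀ y₁ y₂ z₁ z₂ → Dec (Type4Profile y₁ y₂ z₁ z₂)
type4-profile? y₁ y₂ z₁ z₂ =
  (0 <? y₁ →-dec z₁ ≤? 1) ×-dec (0 <? z₁ →-dec y₁ ≤? 1) ×-dec
  (0 <? y₂ →-dec _ ≤? 6) ×-dec (0 <? z₂ →-dec _ ≤? 5) ×-dec
  _ ≤? 9 ×-dec
  8 <? _ ×-dec
  (0 <? _ →-dec _ ≤? 8) ×-dec (0 <? _ →-dec _ ≤? 8)

no-type4-profile : ∀ {y₁} → y₁ < 5 → ∀ {y₂} → y₂ < 5 → ∀ {z₁} → z₁ < 4 → ∀ {z₂} → z₂ < 6 →
                   ¬ Type4Profile y₁ y₂ z₁ z₂
no-type4-profile = from-yes
  (allUpTo? (λ y₁ → allUpTo? (λ y₂ → allUpTo? (λ z₁ → allUpTo? (λ z₂ →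
    ¬? (type4-profile? y₁ y₂ z₁ z₂)) 6) 4) 5) 5)

module ObstructionTypes {H M₁ M₂ : BiGraph 8} (H-bigraph : IsBigraph 8 3 H) (M₂-matching : IsMatching M₂) where

  private
    G : BiGraph 8
    G = (H +E M₁) -E M₂

  type1⇒no-obstruction : ∀ {X} → Type1 H X → HasMatching2 G X (∁ (N H X)) → ∀ Y → ¬ IsObstruction G Y
  type1⇒no-obstruction {X} (∣X∣≡5 , ∣C∣≡3) matching Y violated =
    no-type1-profile (s≤s (∣p∩q∣≤m Y X ∣X∣≡5)) (s≤s (∣p∩q∣≤m Y (∁ X) ∣∁X∣≡3))
                     (s≤s (∣p∩q∣≤m Z C ∣C∣≡3)) (s≤s (∣p∩q∣≤m Z (∁ C) ∣∁C∣≡5))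
      (proj₁ inner , proj₂ inner , proj₁ outer , proj₂ outer , matched , large)
    where
    open Perturbation {H = H} {M₁ = M₁} {M₂ = M₂} M₂-matching Y
    C = N H X
    ∣∁X∣≡3 = trans (∣∁p∣≡n∸∣p∣ X) (cong (8 ∸_) ∣X∣≡5)
    ∣∁C∣≡5 = trans (∣∁p∣≡n∸∣p∣ C) (cong (8 ∸_) ∣C∣≡3)
    large = subst₂ (λ y z → 8 < y + z) (∣p∣≡∣p∩q∣+∣p∩∁q∣ Y X) (∣p∣≡∣p∩q∣+∣p∩∁q∣ Z C)
                   (violated⇒n<∣Y∣+∣Z∣ violated)
    inner = complete-block (complete-onto-N {H = H} H-bigraph (≤-reflexive ∣C∣≡3))
    outer = complete-block (complete-off-N {H = H} H-bigraph (≤-reflexive ∣∁X∣≡3))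
    matched = subst (∣ Y ∩ X ∣ + ∣ Z ∩ ∁ C ∣ + 2 ≤_) (cong₂ _+_ ∣X∣≡5 ∣∁C∣≡5)
                    (matching2⇒∣Y∩S∣+∣Z∩T∣+2≤∣S∣+∣T∣ matching)

  -- Types 2 and 3 are treated together: of the removed edges in their
  -- definitions only the consequence ∣ N H (X ∪ ⁅ x₁ ⁆) ∣ ≤ 5 is needed.
  type23⇒no-obstruction : IsBigraph 8 3 G → ∀ {X x₁} → ∣ X ∣ ≡ 4 → ∣ N H X ∣ ≡ 3 → x₁ ∉ X →
                          ∣ N H (X ∪ ⁅ x₁ ⁆) ∣ ≤ 5 → HasMatching2 G (X ∪ ⁅ x₁ ⁆) (∁ (N H X)) →
                          ∀ Y → ¬ IsObstruction G Y
  type23⇒no-obstruction G-bigraph {X} {x₁} ∣X∣≡4 ∣C∣≡3 x₁∉X ∣C′∣≤5 matching Y violated =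
    no-type23-profile (s≤s (∣p∩q∣≤m Y X ∣X∣≡4)) (s≤s (∣p∩q∣≤m Y (X′ ∩ ∁ X) ∣X′∖X∣≡1))
                      (s≤s (∣p∩q∣≤m Y (∁ X′) ∣∁X′∣≡3)) (s≤s (∣p∩q∣≤m Z C ∣C∣≡3))
                      (s≤s (≤-trans (∣p∩q∣≤∣q∣ Z (C′ ∩ ∁ C)) ∣C′∖C∣≤2)) (s≤s (m+n≤o⇒n≤o _ z₀+z₂≤5))
      ( proj₁ inner , proj₂ inner , proj₁ outer , proj₂ outer , x₁-block , z₀+z₂≤5 , matched
      , obstruction-sizes G-bigraph violated ∣Y∣≡ ∣Z∣≡ )
    where
    open Perturbation {H = H} {M₁ = M₁} {M₂ = M₂} M₂-matching Y
    X′ = X ∪ ⁅ x₁ ⁆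
    C = N H X
    C′ = N H X′
    X⊆X′ : X ⊆ X′
    X⊆X′ = p⊆p∪q ⁅ x₁ ⁆
    C⊆C′ : C ⊆ C′
    C⊆C′ = N-mono H X⊆X′
    ∣X′∣≡5 = trans (x∉p⇒∣p∪⁅x⁆∣≡1+∣p∣ x₁∉X) (cong suc ∣X∣≡4)
    ∣∁X′∣≡3 = trans (∣∁p∣≡n∸∣p∣ X′) (cong (8 ∸_) ∣X′∣≡5)
    ∣∁C∣≡5 = trans (∣∁p∣≡n∸∣p∣ C) (cong (8 ∸_) ∣C∣≡3)
    ∣X′∖X∣≡1 : ∣ X′ ∩ ∁ X ∣ ≡ 1
    ∣X′∖X∣≡1 = +-cancelˡ-≡ 4 _ _ (begin
      4 + ∣ X′ ∩ ∁ X ∣        ≡⟨ cong (_+ ∣ X′ ∩ ∁ X ∣) ∣X∣≡4 ⟨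
      ∣ X ∣ + ∣ X′ ∩ ∁ X ∣    ≡⟨ p⊆q⇒∣q∣≡∣p∣+∣q∩∁p∣ {p = X} {q = X′} X⊆X′ ⟨
      ∣ X′ ∣                  ≡⟨ ∣X′∣≡5 ⟩
      5                       ∎)
      where open ≡-Reasoning
    ∣C′∖C∣≤2 : ∣ C′ ∩ ∁ C ∣ ≤ 2
    ∣C′∖C∣≤2 = +-cancelˡ-≤ 3 _ _
      (subst (_≤ 5) (trans (p⊆q⇒∣q∣≡∣p∣+∣q∩∁p∣ {p = C} {q = C′} C⊆C′) (cong (_+ ∣ C′ ∩ ∁ C ∣) ∣C∣≡3)) ∣C′∣≤5)
    ∣Y∣≡ = ∣s∣≡∣s∩p∣+∣s∩[q∩∁p]∣+∣s∩∁q∣ Y X⊆X′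
    ∣Z∣≡ = ∣s∣≡∣s∩p∣+∣s∩[q∩∁p]∣+∣s∩∁q∣ Z C⊆C′
    inner = complete-block (complete-onto-N {H = H} H-bigraph (≤-reflexive ∣C∣≡3))
    outer = complete-block (complete-off-N {H = H} H-bigraph (≤-reflexive ∣∁X′∣≡3))
    x₁-block : 0 < ∣ Y ∩ (X′ ∩ ∁ X) ∣ → ∣ Z ∩ C ∣ + ∣ Z ∩ (C′ ∩ ∁ C) ∣ + 3 ≤ 6
    x₁-block 0<y₀ = subst (λ z → z + 3 ≤ 6) (∣s∩q∣≡∣s∩p∣+∣s∩[q∩∁p]∣ Z C⊆C′) (≤-trans
      (degree-block-Z {Q = X′ ∩ ∁ X} {P = C′}
        (λ a∈ → degree-into-N {H = H} H-bigraph {X = X′} (p∩q⊆p X′ (∁ X) a∈)) 0<y₀)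
      (+-monoˡ-≤ 1 ∣C′∣≤5))
    ∣Z∩∁C∣≡ = ∣s∩∁p∣≡∣s∩[q∩∁p]∣+∣s∩∁q∣ Z C⊆C′
    z₀+z₂≤5 = subst (_≤ 5) ∣Z∩∁C∣≡ (∣p∩q∣≤m Z (∁ C) ∣∁C∣≡5)
    matched = subst₂ (λ y z → y + z + 2 ≤ 10) (∣s∩q∣≡∣s∩p∣+∣s∩[q∩∁p]∣ Y X⊆X′) ∣Z∩∁C∣≡
                (subst (∣ Y ∩ X′ ∣ + ∣ Z ∩ ∁ C ∣ + 2 ≤_) (cong₂ _+_ ∣X′∣≡5 ∣∁C∣≡5)
                       (matching2⇒∣Y∩S∣+∣Z∩T∣+2≤∣S∣+∣T∣ matching))

  type4⇒no-obstruction : IsBigraph 8 3 G → ∀ {X} → Type4 H X → HasEdgeBetween G X (∁ (N H X)) →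
                         ∀ Y → ¬ IsObstruction G Y
  type4⇒no-obstruction G-bigraph {X} type4@(∣X∣≡4 , ∣C∣≡3 , _) edge Y violated =
    no-type4-profile (s≤s (∣p∩q∣≤m Y X ∣X∣≡4)) (s≤s (∣p∩q∣≤m Y (∁ X) ∣∁X∣≡4))
                     (s≤s (∣p∩q∣≤m Z C ∣C∣≡3)) (s≤s (∣p∩q∣≤m Z (∁ C) ∣∁C∣≡5))
      ( proj₁ inner , proj₂ inner
      , (λ 0<y₂ → subst (λ m → ∣ Z ∩ ∁ C ∣ + 3 ≤ m + 1) ∣∁C∣≡5
                    (degree-block-Z {Q = ∁ X} {P = ∁ C} (λ a∈∁X → type4⇒outer-degree type4 (x∈∁p⇒x∉p a∈∁X)) 0<y₂))
      , (λ 0<z₂ → subst (λ m → ∣ Y ∩ ∁ X ∣ + 3 ≤ m + 1) ∣∁X∣≡4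
                    (degree-block-Y {Q = ∁ X} {P = ∁ C} (degree-off-N {H = H} H-bigraph {X = X}) 0<z₂))
      , subst (∣ Y ∩ X ∣ + ∣ Z ∩ ∁ C ∣ + 1 ≤_) (cong₂ _+_ ∣X∣≡4 ∣∁C∣≡5) (edge⇒∣Y∩S∣+∣Z∩T∣+1≤∣S∣+∣T∣ edge)
      , obstruction-sizes G-bigraph violated (∣p∣≡∣p∩q∣+∣p∩∁q∣ Y X) (∣p∣≡∣p∩q∣+∣p∩∁q∣ Z C) )
    where
    open Perturbation {H = H} {M₁ = M₁} {M₂ = M₂} M₂-matching Y
    C = N H X
    ∣∁X∣≡4 = trans (∣∁p∣≡n∸∣p∣ X) (cong (8 ∸_) ∣X∣≡4)
    ∣∁C∣≡5 = trans (∣∁p∣≡n∸∣p∣ C) (cong (8 ∸_) ∣C∣≡3)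
    inner = complete-block (complete-onto-N {H = H} H-bigraph (≤-reflexive ∣C∣≡3))

lemma22 : (H M₁ M₂ : BiGraph 8) → (X : Subset 8)
    → IsBigraph 8 3 H → IsMatching M₁ → IsMatching M₂
    → IsBigraph 8 3 ((H +E M₁) -E M₂)
    → (Type1 H X → HasMatching2 ((H +E M₁) -E M₂) X (∁ (N H X)) → HasOneFactor ((H +E M₁) -E M₂))
    × (∀ x₁ b₁ → Type2Wit H X x₁ b₁ → HasMatching2 ((H +E M₁) -E M₂) (X ∪ ⁅ x₁ ⁆) (∁ (N H X)) → HasOneFactor ((H +E M₁) -E M₂))
    × (∀ x₁ b₁ b₂ → Type3Wit H X x₁ b₁ b₂ → HasMatching2 ((H +E M₁) -E M₂) (X ∪ ⁅ x₁ ⁆) (∁ (N H X)) → HasOneFactor ((H +E M₁) -E M₂))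
    × (Type4 H X → HasEdgeBetween ((H +E M₁) -E M₂) X (∁ (N H X)) → HasOneFactor ((H +E M₁) -E M₂))
-- M₁ only adds edges, so it need not be a matching.
lemma22 H M₁ M₂ X H-bigraph _ M₂-matching G-bigraph =
    (λ type1 matching → one-factor (type1⇒no-obstruction type1 matching))
  , (λ x₁ b₁ (∣X∣≡4 , ∣C∣≡3 , x₁∉X , _ , ∣C′∣≡4 , _) matching → one-factor
      (type23⇒no-obstruction G-bigraph ∣X∣≡4 ∣C∣≡3 x₁∉X (≤-trans (≤-reflexive ∣C′∣≡4) (n≤1+n 4)) matching))
  , (λ x₁ b₁ b₂ (∣X∣≡4 , ∣C∣≡3 , x₁∉X , _ , _ , ∣C′∣≡5 , _) matching → one-factor
      (type23⇒no-obstruction G-bigraph ∣X∣≡4 ∣C∣≡3 x₁∉X (≤-reflexive ∣C′∣≡5) matching))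
  , (λ type4 edge → one-factor (type4⇒no-obstruction G-bigraph type4 edge))
  where
  open ObstructionTypes {H = H} {M₁ = M₁} {M₂ = M₂} H-bigraph M₂-matching
  one-factor = no-obstruction⇒one-factor ((H +E M₁) -E M₂)
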